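{- Let $J$ be a finite nonempty set of positive integers, and let $\{x_n\}_{n\ge0}$ be defined by $x_0=1$ and $x_n=\sum_{j\in J,\ j\le n} x_{n-j}$ for $n\ge1$. Then: (i) for every $n\ge1$, $x_n=\mathcal{C}_n^{\{J\}}$; (ii) $\displaystyle\sum_{n\ge1}x_nz^n=\frac{\sum_{j\in J}z^j}{1-\sum_{j\in J}z^j}$; (iii) $\{x_n\}_{n\ge1}$ is the sequence of row sums of the general PI tree with input sequence $g_k=1$ if $k\in J$ and $g_k=0$ otherwise ($k\ge1$).
   Context: $\mathcal{C}_n^{\{J\}}$ denotes the number of tuples $(k_1,\dots,k_m)$, $m\ge1$, with $k_1+\dots+k_m=n$ and every $k_i\in J$ (compositions of $n$ with all parts in $J$). General PI tree: given an input sequence $\{g_n\}_{n\ge1}$, build a binary tree whose nodes are words $g_{i_1}\cdots g_{i_k}$; the root (row 1) is $g_1$, and each node $g_{i_1}g_{i_2}\cdots g_{i_k}$ has the two children $g_1g_{i_1}g_{i_2}\cdots g_{i_k}$ and $g_{i_1+1}g_{i_2}\cdots g_{i_k}$. Row $n$ contains $2^{n-1}$ words, and its row sum is the sum over those words of the products of the numbers $g_i$. -}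

module Defs where

open import Data.Nat using (ℕ; zero; suc; _+_; _*_; _∸_; _≤ᵇ_; _≟_)
open import Data.Integer as ℤ using (ℤ)
open import Data.Bool using (Bool; true; false; if_then_else_)
open import Data.Nat.ListAction using (sum; product)
open import Data.List using (List; []; _∷_; [_]; map; concat; concatMap; length; filter; upTo; any)
open import Relation.Nullary.Decidable using (⌊_⌋)
open import Data.List.Relation.Unary.Any using (any?)

-- A finite set J of naturals is represented by a duplicate-free list.

_∈ᵇ_ : ℕ → List ℕ → Bool
k ∈ᵇ J = ⌊ any? (k ≟_) J ⌋

recSum : List ℕ → (ℕ → ℕ) → ℕ → ℕ
recSum J x n = sum (map (λ j → if j ≤ᵇ n then x (n ∸ j) else 0) J)

tuples : List ℕ → ℕ → List (List ℕ)
tuples J zero    = [ [] ]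
tuples J (suc m) = concatMap (λ j → map (j ∷_) (tuples J m)) J

-- all tuples of length m with 1 ≤ m ≤ n  (a composition of n into
-- positive parts has at most n parts)
tuplesUpTo : List ℕ → ℕ → List (List ℕ)
tuplesUpTo J n = concatMap (λ m → tuples J (suc m)) (upTo n)

compCount : List ℕ → ℕ → ℕ
compCount J n = length (filter (λ ks → sum ks ≟ n) (tuplesUpTo J n))

-- General PI tree.  Words g_{i₁}⋯g_{i_k} are lists of indices i₁ ∷ … ∷ i_k.

children : List ℕ → List (List ℕ)
children []       = []
children (i ∷ is) = (1 ∷ i ∷ is) ∷ (suc i ∷ is) ∷ []

-- piRow n = the words in row (n + 1) of the tree; row 1 is the root g₁
piRow : ℕ → List (List ℕ)
piRow zero    = [ 1 ∷ [] ]
piRow (suc n) = concatMap children (piRow n)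

piRowSum : (ℕ → ℕ) → ℕ → ℕ
piRowSum g n = sum (map (λ w → product (map g w)) (piRow n))

indicator : List ℕ → ℕ → ℕ
indicator J k = if k ∈ᵇ J then 1 else 0

Series : Set
Series = ℕ → ℤ

_·ₛ_ : Series → Series → Series
(a ·ₛ b) n = Data.List.foldr ℤ._+_ (ℤ.+ 0) (map (λ i → a i ℤ.* b (n ∸ i)) (upTo (suc n)))

oneₛ : Series
oneₛ zero    = ℤ.+ 1
oneₛ (suc _) = ℤ.+ 0

_-ₛ_ : Series → Series → Series
(a -ₛ b) n = a n ℤ.- b n

Jpoly : List ℕ → Series
Jpoly J k = ℤ.+ (indicator J k)

genFun : (ℕ → ℕ) → Series
genFun x zero    = ℤ.+ 0
genFun x (suc n) = ℤ.+ (x (suc n))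

{-# OPTIONS --safe #-}
-- With g the indicator of J (g 0 = 0, the parts being positive), the recurrence reads
-- x = δ₀ + g ⋆ x for the convolution ⋆ of sequences, i.e. F = G (1 + F) for the generating
-- functions F = Σ_{n≥1} xₙ zⁿ and G = Σ_{j∈J} zʲ, which is (ii).
-- Splitting off the first part, the numbers c_m(s) of compositions of s into m parts from J
-- satisfy c_{m+1} = recSum J c_m. Since recSum J is linear and only reads smaller arguments,
-- Σ_{m<B} c_m agrees with x below B, which gives (i).
-- In the PI tree the left child of a word prepends g₁ and the right child raises its first
-- index by one. Weighting the first letter of every word by an arbitrary h instead of g, the
-- row sums R_h therefore satisfy R_h(n+1) = h₁ R_g(n) + R_{h∘suc}(n), so by induction on n
-- R_h(n) = Σ_{k≤n} h_{k+1} x_{n-k}; h = g gives (iii).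
module Submission where

open import Defs
open import Data.Nat using (ℕ; suc; _<_)
open import Data.List using (List; [])
open import Data.List.Relation.Unary.All using (All)
open import Data.List.Relation.Unary.Unique.Propositional using (Unique)
open import Data.Product using (_×_)
open import Relation.Binary.PropositionalEquality using (_≡_; _≢_)

open import Data.Bool using (true; false; if_then_else_)
open import Data.Integer as ℤ using (ℤ; 0ℤ)
import Data.Integer.Properties as ℤP
open import Data.List
  using (_∷_; _++_; map; concatMap; filter; length; upTo; applyUpTo; applyDownFrom; downFrom; reverse; foldr)
open import Data.List.Properties
  using (map-cong; map-cong-local; map-++; map-upTo; map-applyUpTo; map-downFrom; reverse-upTo; reverse-map;
         filter-++; filter-≐; filter-none; length-++; length-map)
open import Data.List.Relation.Binary.Permutation.Propositional.Properties using (↭-reverse)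
open import Data.List.Relation.Unary.All as All using ([]; _∷_)
open import Data.List.Relation.Unary.All.Properties using (applyUpTo⁺₁; All¬⇒¬Any)
open import Data.List.Relation.Unary.AllPairs using ([]; _∷_)
open import Data.List.Relation.Unary.Any using (any?)
open import Data.Nat using (zero; _+_; _*_; _∸_; _≤_; _≤ᵇ_; _≟_; s≤s)
open import Data.Nat.ListAction using (sum; product)
open import Data.Nat.ListAction.Properties using (sum-++; sum-↭)
open import Data.Nat.Properties
open import Data.Product using (_,_)
open import Function using (_∘_)
open import Relation.Binary.PropositionalEquality
  using (_≗_; refl; sym; trans; cong; cong₂; subst; module ≡-Reasoning)
open import Relation.Nullary using (Reflects; ofʸ; ofⁿ; does; yes; no; contradiction)
open import Relation.Unary using (Pred; Decidable)
open import Algebra.Properties.CommutativeSemigroup +-commutativeSemigroup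
  using () renaming (interchange to +-interchange)
open import Algebra.Properties.CommutativeSemigroup ℤP.+-commutativeSemigroup
  using () renaming (interchange to ℤ+-interchange)

open ≡-Reasoning

-- Sums of lists and of ranges

module _ {a} {A : Set a} where

  sum-map-0 : (xs : List A) → sum (map (λ _ → 0) xs) ≡ 0
  sum-map-0 []       = refl
  sum-map-0 (_ ∷ xs) = sum-map-0 xs

  sum-map-+ : (f g : A → ℕ) (xs : List A) →
              sum (map (λ a → f a + g a) xs) ≡ sum (map f xs) + sum (map g xs)
  sum-map-+ f g []       = refl
  sum-map-+ f g (a ∷ xs) =
    trans (cong (f a + g a +_) (sum-map-+ f g xs)) (+-interchange (f a) (g a) _ _)

  sum-map-*ˡ : (c : ℕ) (f : A → ℕ) (xs : List A) →
               sum (map (λ a → c * f a) xs) ≡ c * sum (map f xs)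
  sum-map-*ˡ c f []       = sym (*-zeroʳ c)
  sum-map-*ˡ c f (a ∷ xs) =
    trans (cong (c * f a +_) (sum-map-*ˡ c f xs)) (sym (*-distribˡ-+ c (f a) _))

  sum-map-concatMap : ∀ {b} {B : Set b} (h : B → ℕ) (f : A → List B) (xs : List A) →
                      sum (map h (concatMap f xs)) ≡ sum (map (λ a → sum (map h (f a))) xs)
  sum-map-concatMap h f []       = refl
  sum-map-concatMap h f (a ∷ xs) = begin
    sum (map h (f a ++ concatMap f xs))
      ≡⟨ cong sum (map-++ h (f a) _) ⟩
    sum (map h (f a) ++ map h (concatMap f xs))
      ≡⟨ sum-++ (map h (f a)) _ ⟩
    sum (map h (f a)) + sum (map h (concatMap f xs))
      ≡⟨ cong (sum (map h (f a)) +_) (sum-map-concatMap h f xs) ⟩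
    sum (map (λ a → sum (map h (f a))) (a ∷ xs)) ∎

∑< : ℕ → (ℕ → ℕ) → ℕ
∑< n f = sum (map f (upTo n))

infix 5 ∑<
syntax ∑< n (λ i → e) = ∑[ i < n ] e

∑-suc : ∀ n (f : ℕ → ℕ) → ∑[ i < suc n ] f i ≡ f 0 + (∑[ i < n ] f (suc i))
∑-suc n f =
  cong (λ xs → f 0 + sum xs) (trans (map-applyUpTo suc f n) (sym (map-upTo (f ∘ suc) n)))

∑-cong-< : ∀ n {f g : ℕ → ℕ} → (∀ {i} → i < n → f i ≡ g i) → ∑[ i < n ] f i ≡ ∑[ i < n ] g i
∑-cong-< n f≡g = cong sum (map-cong-local (applyUpTo⁺₁ (λ i → i) n f≡g))

applyDownFrom-applyUpTo : ∀ {a} {A : Set a} (f : ℕ → A) n →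
                          applyDownFrom f n ≡ applyUpTo (λ i → f (n ∸ suc i)) n
applyDownFrom-applyUpTo f zero    = refl
applyDownFrom-applyUpTo f (suc n) = cong (f n ∷_) (applyDownFrom-applyUpTo f n)

∑-reverse : ∀ n (f : ℕ → ℕ) → ∑[ i < n ] f i ≡ ∑[ i < n ] f (n ∸ suc i)
∑-reverse n f = begin
  sum (map f (upTo n))                         ≡⟨ sum-↭ (↭-reverse (map f (upTo n))) ⟨
  sum (reverse (map f (upTo n)))               ≡⟨ cong sum (reverse-map f (upTo n)) ⟨
  sum (map f (reverse (upTo n)))               ≡⟨ cong (sum ∘ map f) (reverse-upTo n) ⟩
  sum (map f (downFrom n))                     ≡⟨ cong sum (map-downFrom f n) ⟩
  sum (applyDownFrom f n)                      ≡⟨ cong sum (applyDownFrom-applyUpTo f n) ⟩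
  sum (applyUpTo (λ i → f (n ∸ suc i)) n)      ≡⟨ cong sum (map-upTo (λ i → f (n ∸ suc i)) n) ⟨
  sum (map (λ i → f (n ∸ suc i)) (upTo n))     ∎

-- Convolution of sequences

infixl 7 _⋆_

_⋆_ : (ℕ → ℕ) → (ℕ → ℕ) → ℕ → ℕ
(a ⋆ b) n = ∑[ i < suc n ] a i * b (n ∸ i)

⋆-suc : ∀ (a b : ℕ → ℕ) n → (a ⋆ b) (suc n) ≡ a 0 * b (suc n) + ((a ∘ suc) ⋆ b) n
⋆-suc a b n = ∑-suc (suc n) (λ i → a i * b (suc n ∸ i))

⋆-congˡ : ∀ {a a' : ℕ → ℕ} (b : ℕ → ℕ) → a ≗ a' → ∀ n → (a ⋆ b) n ≡ (a' ⋆ b) n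
⋆-congˡ b a≗a' n = cong sum (map-cong (λ i → cong (_* b (n ∸ i)) (a≗a' i)) (upTo (suc n)))

⋆-distribʳ-+ : ∀ (a a' b : ℕ → ℕ) n → ((λ k → a k + a' k) ⋆ b) n ≡ (a ⋆ b) n + (a' ⋆ b) n
⋆-distribʳ-+ a a' b n = begin
  ∑[ i < suc n ] (a i + a' i) * b (n ∸ i)
    ≡⟨ cong sum (map-cong (λ i → *-distribʳ-+ (b (n ∸ i)) (a i) (a' i)) (upTo (suc n))) ⟩
  ∑[ i < suc n ] (a i * b (n ∸ i) + a' i * b (n ∸ i))
    ≡⟨ sum-map-+ (λ i → a i * b (n ∸ i)) (λ i → a' i * b (n ∸ i)) (upTo (suc n)) ⟩
  (a ⋆ b) n + (a' ⋆ b) n ∎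

⋆-comm : ∀ (a b : ℕ → ℕ) n → (a ⋆ b) n ≡ (b ⋆ a) n
⋆-comm a b n = begin
  ∑[ i < suc n ] a i * b (n ∸ i)              ≡⟨ ∑-reverse (suc n) (λ i → a i * b (n ∸ i)) ⟩
  ∑[ i < suc n ] a (n ∸ i) * b (n ∸ (n ∸ i))  ≡⟨ ∑-cong-< (suc n) swap ⟩
  ∑[ i < suc n ] b i * a (n ∸ i)              ∎
  where
  swap : ∀ {i} → i < suc n → a (n ∸ i) * b (n ∸ (n ∸ i)) ≡ b i * a (n ∸ i)
  swap {i} (s≤s i≤n) =
    trans (cong (λ j → a (n ∸ i) * b j) (m∸[m∸n]≡n i≤n)) (*-comm (a (n ∸ i)) (b i))

δ : ℕ → ℕ → ℕ
δ zero    zero    = 1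
δ zero    (suc _) = 0
δ (suc _) zero    = 0
δ (suc a) (suc k) = δ a k

δ-diag : ∀ a → δ a a ≡ 1
δ-diag zero    = refl
δ-diag (suc a) = δ-diag a

δ-off : ∀ {a k} → k ≢ a → δ a k ≡ 0
δ-off {zero}  {zero}  0≢0   = contradiction refl 0≢0
δ-off {zero}  {suc k} _     = refl
δ-off {suc a} {zero}  _     = refl
δ-off {suc a} {suc k} k+≢a+ = δ-off (k+≢a+ ∘ cong suc)

≤ᵇ-suc : ∀ m n → (suc m ≤ᵇ suc n) ≡ (m ≤ᵇ n)
≤ᵇ-suc zero    n = refl
≤ᵇ-suc (suc m) n = refl

⋆-δ : ∀ a (f : ℕ → ℕ) n → (δ a ⋆ f) n ≡ (if a ≤ᵇ n then f (n ∸ a) else 0)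
⋆-δ zero    f n       = begin
  (δ 0 ⋆ f) n                                ≡⟨ ∑-suc n (λ i → δ 0 i * f (n ∸ i)) ⟩
  f n + 0 + sum (map (λ _ → 0) (upTo n))     ≡⟨ cong (f n + 0 +_) (sum-map-0 (upTo n)) ⟩
  f n + 0 + 0                                ≡⟨ trans (+-identityʳ _) (+-identityʳ (f n)) ⟩
  f n                                        ∎
⋆-δ (suc a) f zero    = refl
⋆-δ (suc a) f (suc n) = begin
  (δ (suc a) ⋆ f) (suc n)                    ≡⟨ ⋆-suc (δ (suc a)) f n ⟩
  (δ a ⋆ f) n                                ≡⟨ ⋆-δ a f n ⟩
  (if a ≤ᵇ n then f (n ∸ a) else 0)          ≡⟨ cong (if_then f (n ∸ a) else 0) (≤ᵇ-suc a n) ⟨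
  (if suc a ≤ᵇ suc n then f (n ∸ a) else 0)  ∎

⋆-identityʳ : ∀ (f : ℕ → ℕ) n → (f ⋆ δ 0) n ≡ f n
⋆-identityʳ f n = trans (⋆-comm f (δ 0) n) (⋆-δ 0 f n)

-- The recurrence operator recSum J

indicator-∉ : ∀ {a} {J : List ℕ} → All (a ≢_) J → indicator J a ≡ 0
indicator-∉ {a} {J} a∉J with any? (a ≟_) J
... | yes a∈J = contradiction a∈J (All¬⇒¬Any a∉J)
... | no  _   = refl

indicator-∷ : ∀ {a} {J : List ℕ} → All (a ≢_) J → ∀ k → indicator (a ∷ J) k ≡ δ a k + indicator J k
indicator-∷ {a} {J} a∉J k with k ≟ a | any? (k ≟_) J
... | yes refl | yes a∈J = contradiction a∈J (All¬⇒¬Any a∉J)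
... | yes refl | no  _   = sym (trans (+-identityʳ (δ a a)) (δ-diag a))
... | no  k≢a  | yes _   = cong (_+ 1) (sym (δ-off k≢a))
... | no  k≢a  | no  _   = cong (_+ 0) (sym (δ-off k≢a))

recSum-⋆ : ∀ {J} → Unique J → ∀ f n → recSum J f n ≡ (indicator J ⋆ f) n
recSum-⋆ {[]}    []               f n = sym (sum-map-0 (upTo (suc n)))
recSum-⋆ {a ∷ J} (a∉J ∷ J-unique) f n = begin
  (if a ≤ᵇ n then f (n ∸ a) else 0) + recSum J f n
    ≡⟨ cong₂ _+_ (sym (⋆-δ a f n)) (recSum-⋆ J-unique f n) ⟩
  (δ a ⋆ f) n + (indicator J ⋆ f) n
    ≡⟨ ⋆-distribʳ-+ (δ a) (indicator J) f n ⟨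
  ((λ k → δ a k + indicator J k) ⋆ f) n
    ≡⟨ ⋆-congˡ f (λ k → sym (indicator-∷ a∉J k)) n ⟩
  (indicator (a ∷ J) ⋆ f) n ∎

recSum-0 : ∀ J n → recSum J (λ _ → 0) n ≡ 0
recSum-0 []      n = refl
recSum-0 (j ∷ J) n with j ≤ᵇ n
... | true  = recSum-0 J n
... | false = recSum-0 J n

recSum-+ : ∀ J (f g : ℕ → ℕ) n → recSum J (λ k → f k + g k) n ≡ recSum J f n + recSum J g n
recSum-+ []      f g n = refl
recSum-+ (j ∷ J) f g n with j ≤ᵇ n
... | true  = trans (cong (f (n ∸ j) + g (n ∸ j) +_) (recSum-+ J f g n))
                    (+-interchange (f (n ∸ j)) (g (n ∸ j)) _ _)
... | false = recSum-+ J f g n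

recSum-sum : ∀ J {a} {A : Set a} (F : A → ℕ → ℕ) (ms : List A) n →
             recSum J (λ k → sum (map (λ m → F m k) ms)) n ≡ sum (map (λ m → recSum J (F m) n) ms)
recSum-sum J F []       n = recSum-0 J n
recSum-sum J F (m ∷ ms) n =
  trans (recSum-+ J (F m) (λ k → sum (map (λ m → F m k) ms)) n)
        (cong (recSum J (F m) n +_) (recSum-sum J F ms n))

recSum-cong-< : ∀ {J} → All (0 <_) J → ∀ {f g : ℕ → ℕ} n →
                (∀ {k} → k < n → f k ≡ g k) → recSum J f n ≡ recSum J g n
recSum-cong-< []                n f≡g = refl
recSum-cong-< {j ∷ _} (0<j ∷ J-pos) n f≡g with j ≤ᵇ n | ≤ᵇ-reflects-≤ j n
... | true  | ofʸ j≤n = cong₂ _+_ (f≡g (∸-monoʳ-< 0<j j≤n)) (recSum-cong-< J-pos n f≡g)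
... | false | ofⁿ _   = recSum-cong-< J-pos n f≡g

-- Compositions

module _ {a b p} {A : Set a} {B : Set b} {P : Pred B p} (P? : Decidable P) where

  filter-map : (f : A → B) (xs : List A) → filter P? (map f xs) ≡ map f (filter (P? ∘ f) xs)
  filter-map f []       = refl
  filter-map f (x ∷ xs) with does (P? (f x))
  ... | true  = cong (f x ∷_) (filter-map f xs)
  ... | false = filter-map f xs

  length-filter-concatMap : (f : A → List B) (xs : List A) →
    length (filter P? (concatMap f xs)) ≡ sum (map (λ a → length (filter P? (f a))) xs)
  length-filter-concatMap f []       = refl
  length-filter-concatMap f (a ∷ xs) = begin
    length (filter P? (f a ++ concatMap f xs))
      ≡⟨ cong length (filter-++ P? (f a) (concatMap f xs)) ⟩
    length (filter P? (f a) ++ filter P? (concatMap f xs))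
      ≡⟨ length-++ (filter P? (f a)) ⟩
    length (filter P? (f a)) + length (filter P? (concatMap f xs))
      ≡⟨ cong (length (filter P? (f a)) +_) (length-filter-concatMap f xs) ⟩
    sum (map (λ a → length (filter P? (f a))) (a ∷ xs)) ∎

countSum : ℕ → List (List ℕ) → ℕ
countSum s kss = length (filter (λ ks → sum ks ≟ s) kss)

countSum-map-∷ : ∀ j s kss →
                 countSum s (map (j ∷_) kss) ≡ (if j ≤ᵇ s then countSum (s ∸ j) kss else 0)
countSum-map-∷ j s kss = trans count-tails (by-cases (j ≤ᵇ s) (≤ᵇ-reflects-≤ j s))
  where
  count-tails : countSum s (map (j ∷_) kss) ≡ length (filter (λ ks → j + sum ks ≟ s) kss)
  count-tails = trans (cong length (filter-map (λ ks → sum ks ≟ s) (j ∷_) kss))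
                      (length-map (j ∷_) (filter (λ ks → j + sum ks ≟ s) kss))

  by-cases : ∀ b → Reflects (j ≤ s) b →
             length (filter (λ ks → j + sum ks ≟ s) kss) ≡ (if b then countSum (s ∸ j) kss else 0)
  by-cases true  (ofʸ j≤s) =
    cong length (filter-≐ (λ ks → j + sum ks ≟ s) (λ ks → sum ks ≟ s ∸ j) (take-j , give-j) kss)
    where
    take-j : ∀ {t} → j + t ≡ s → t ≡ s ∸ j
    take-j {t} j+t≡s = trans (sym (m+n∸m≡n j t)) (cong (_∸ j) j+t≡s)
    give-j : ∀ {t} → t ≡ s ∸ j → j + t ≡ s
    give-j t≡s∸j = trans (cong (j +_) t≡s∸j) (m+[n∸m]≡n j≤s)
  by-cases false (ofⁿ j≰s) =
    cong length (filter-none (λ ks → j + sum ks ≟ s) (All.universal too-large kss))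
    where
    too-large : ∀ ks → j + sum ks ≢ s
    too-large ks j+t≡s = j≰s (subst (j ≤_) j+t≡s (m≤m+n j (sum ks)))

module Compositions (J : List ℕ) where

  compCountOfLength : ℕ → ℕ → ℕ
  compCountOfLength m s = countSum s (tuples J m)

  compCountOfLength-suc : ∀ m s → compCountOfLength (suc m) s ≡ recSum J (compCountOfLength m) s
  compCountOfLength-suc m s = begin
    countSum s (concatMap (λ j → map (j ∷_) (tuples J m)) J)
      ≡⟨ length-filter-concatMap (λ ks → sum ks ≟ s) (λ j → map (j ∷_) (tuples J m)) J ⟩
    sum (map (λ j → countSum s (map (j ∷_) (tuples J m))) J)
      ≡⟨ cong sum (map-cong (λ j → countSum-map-∷ j s (tuples J m)) J) ⟩
    recSum J (compCountOfLength m) s ∎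

  compCountBelow : ℕ → ℕ → ℕ
  compCountBelow B s = ∑[ m < B ] compCountOfLength m s

  compCountBelow-suc : ∀ B s →
    compCountBelow (suc B) s ≡ compCountOfLength 0 s + recSum J (compCountBelow B) s
  compCountBelow-suc B s = begin
    compCountBelow (suc B) s
      ≡⟨ ∑-suc B (λ m → compCountOfLength m s) ⟩
    compCountOfLength 0 s + (∑[ m < B ] compCountOfLength (suc m) s)
      ≡⟨ cong (λ c → compCountOfLength 0 s + sum c) (map-cong (λ m → compCountOfLength-suc m s) (upTo B)) ⟩
    compCountOfLength 0 s + sum (map (λ m → recSum J (compCountOfLength m) s) (upTo B))
      ≡⟨ cong (compCountOfLength 0 s +_) (recSum-sum J compCountOfLength (upTo B) s) ⟨
    compCountOfLength 0 s + recSum J (compCountBelow B) s ∎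

  compCount-suc : ∀ n → compCount J (suc n) ≡ compCountBelow (suc (suc n)) (suc n)
  compCount-suc n = begin
    compCount J (suc n)
      ≡⟨ length-filter-concatMap (λ ks → sum ks ≟ suc n) (λ m → tuples J (suc m)) (upTo (suc n)) ⟩
    ∑[ m < suc n ] compCountOfLength (suc m) (suc n)
      ≡⟨ ∑-suc (suc n) (λ m → compCountOfLength m (suc n)) ⟨
    compCountBelow (suc (suc n)) (suc n) ∎

  module _ (J-pos : All (0 <_) J) (x : ℕ → ℕ) (x0 : x 0 ≡ 1)
           (x-rec : ∀ n → x (suc n) ≡ recSum J x (suc n)) where

    x-fixpoint : ∀ n → x n ≡ compCountOfLength 0 n + recSum J x n
    x-fixpoint zero    = begin
      x 0                          ≡⟨ x0 ⟩
      1                            ≡⟨ cong suc (recSum-0 J 0) ⟨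
      1 + recSum J (λ _ → 0) 0     ≡⟨ cong suc (recSum-cong-< J-pos {x} {λ _ → 0} 0 (λ ())) ⟨
      1 + recSum J x 0             ∎
    x-fixpoint (suc n) = x-rec n

    compCountBelow≡x : ∀ B {n} → n < B → compCountBelow B n ≡ x n
    compCountBelow≡x (suc B) {n} (s≤s n≤B) = begin
      compCountBelow (suc B) n
        ≡⟨ compCountBelow-suc B n ⟩
      compCountOfLength 0 n + recSum J (compCountBelow B) n
        ≡⟨ cong (compCountOfLength 0 n +_)
                (recSum-cong-< J-pos n (λ k<n → compCountBelow≡x B (<-≤-trans k<n n≤B))) ⟩
      compCountOfLength 0 n + recSum J x n
        ≡⟨ x-fixpoint n ⟨
      x n ∎

    compCount-solution : ∀ n → x (suc n) ≡ compCount J (suc n)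
    compCount-solution n = sym (trans (compCount-suc n) (compCountBelow≡x (suc (suc n)) ≤-refl))

-- The PI tree

module PITree (g : ℕ → ℕ) where

  leadWeight : (ℕ → ℕ) → List ℕ → ℕ
  leadWeight h []      = 0
  leadWeight h (i ∷ w) = h i * product (map g w)

  leadRowSum : (ℕ → ℕ) → ℕ → ℕ
  leadRowSum h n = sum (map (leadWeight h) (piRow n))

  leadWeight-children : ∀ h w →
    sum (map (leadWeight h) (children w)) ≡ h 1 * leadWeight g w + leadWeight (h ∘ suc) w
  leadWeight-children h []      = cong (_+ 0) (sym (*-zeroʳ (h 1)))
  leadWeight-children h (i ∷ w) = cong (h 1 * (g i * product (map g w)) +_) (+-identityʳ _)

  leadRowSum-suc : ∀ h n → leadRowSum h (suc n) ≡ h 1 * leadRowSum g n + leadRowSum (h ∘ suc) n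
  leadRowSum-suc h n = begin
    sum (map (leadWeight h) (concatMap children (piRow n)))
      ≡⟨ sum-map-concatMap (leadWeight h) children (piRow n) ⟩
    sum (map (λ w → sum (map (leadWeight h) (children w))) (piRow n))
      ≡⟨ cong sum (map-cong (leadWeight-children h) (piRow n)) ⟩
    sum (map (λ w → h 1 * leadWeight g w + leadWeight (h ∘ suc) w) (piRow n))
      ≡⟨ sum-map-+ (λ w → h 1 * leadWeight g w) (leadWeight (h ∘ suc)) (piRow n) ⟩
    sum (map (λ w → h 1 * leadWeight g w) (piRow n)) + leadRowSum (h ∘ suc) n
      ≡⟨ cong (_+ leadRowSum (h ∘ suc) n) (sum-map-*ˡ (h 1) (leadWeight g) (piRow n)) ⟩
    h 1 * leadRowSum g n + leadRowSum (h ∘ suc) n ∎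

  piRowSum≡leadRowSum : ∀ n → piRowSum g n ≡ leadRowSum g n
  piRowSum≡leadRowSum zero    = refl
  piRowSum≡leadRowSum (suc n) = begin
    sum (map (product ∘ map g) (concatMap children (piRow n)))
      ≡⟨ sum-map-concatMap (product ∘ map g) children (piRow n) ⟩
    sum (map (λ w → sum (map (product ∘ map g) (children w))) (piRow n))
      ≡⟨ cong sum (map-cong children-agree (piRow n)) ⟩
    sum (map (λ w → sum (map (leadWeight g) (children w))) (piRow n))
      ≡⟨ sum-map-concatMap (leadWeight g) children (piRow n) ⟨
    leadRowSum g (suc n) ∎
    where
    children-agree : ∀ w →
      sum (map (product ∘ map g) (children w)) ≡ sum (map (leadWeight g) (children w))
    children-agree []      = refl
    children-agree (i ∷ w) = refl

  module _ (x : ℕ → ℕ) (x0 : x 0 ≡ 1) (x-rec : ∀ n → x (suc n) ≡ ((g ∘ suc) ⋆ x) n) where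

    leadRowSum-⋆ : ∀ n h → leadRowSum h n ≡ ((h ∘ suc) ⋆ x) n
    leadRowSum-⋆ zero    h = cong (λ c → h 1 * c + 0) (sym x0)
    leadRowSum-⋆ (suc n) h = begin
      leadRowSum h (suc n)
        ≡⟨ leadRowSum-suc h n ⟩
      h 1 * leadRowSum g n + leadRowSum (h ∘ suc) n
        ≡⟨ cong₂ (λ r s → h 1 * r + s) (trans (leadRowSum-⋆ n g) (sym (x-rec n)))
                                       (leadRowSum-⋆ n (h ∘ suc)) ⟩
      h 1 * x (suc n) + ((h ∘ suc ∘ suc) ⋆ x) n
        ≡⟨ ⋆-suc (h ∘ suc) x n ⟨
      ((h ∘ suc) ⋆ x) (suc n) ∎

    piRowSum-solution : ∀ n → x (suc n) ≡ piRowSum g n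
    piRowSum-solution n = begin
      x (suc n)              ≡⟨ x-rec n ⟩
      ((g ∘ suc) ⋆ x) n      ≡⟨ leadRowSum-⋆ n g ⟨
      leadRowSum g n         ≡⟨ piRowSum≡leadRowSum n ⟨
      piRowSum g n           ∎

-- Formal power series

module _ {a} {A : Set a} where

  sumℤ-map-- : (f g : A → ℤ) (xs : List A) →
    foldr ℤ._+_ 0ℤ (map (λ a → f a ℤ.- g a) xs)
      ≡ foldr ℤ._+_ 0ℤ (map f xs) ℤ.- foldr ℤ._+_ 0ℤ (map g xs)
  sumℤ-map-- f g []       = refl
  sumℤ-map-- f g (a ∷ xs) = begin
    (f a ℤ.- g a) ℤ.+ foldr ℤ._+_ 0ℤ (map (λ a → f a ℤ.- g a) xs)
      ≡⟨ cong (λ z → (f a ℤ.- g a) ℤ.+ z) (sumℤ-map-- f g xs) ⟩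
    (f a ℤ.- g a) ℤ.+ (F ℤ.- G)
      ≡⟨ ℤ+-interchange (f a) (ℤ.- g a) F (ℤ.- G) ⟩
    (f a ℤ.+ F) ℤ.+ (ℤ.- g a ℤ.+ ℤ.- G)
      ≡⟨ cong (λ z → (f a ℤ.+ F) ℤ.+ z) (ℤP.neg-distrib-+ (g a) G) ⟨
    (f a ℤ.+ F) ℤ.- (g a ℤ.+ G) ∎
    where
    F G : ℤ
    F = foldr ℤ._+_ 0ℤ (map f xs)
    G = foldr ℤ._+_ 0ℤ (map g xs)

  sumℤ-map-pos : (f : A → ℕ) (xs : List A) →
                 foldr ℤ._+_ 0ℤ (map (λ a → ℤ.+ f a) xs) ≡ ℤ.+ sum (map f xs)
  sumℤ-map-pos f []       = refl
  sumℤ-map-pos f (a ∷ xs) =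
    trans (cong (λ z → ℤ.+ f a ℤ.+ z) (sumℤ-map-pos f xs)) (sym (ℤP.pos-+ (f a) _))

·ₛ-cong : ∀ {a a' b b' : Series} → a ≗ a' → b ≗ b' → ∀ n → (a ·ₛ b) n ≡ (a' ·ₛ b') n
·ₛ-cong a≗a' b≗b' n =
  cong (foldr ℤ._+_ 0ℤ) (map-cong (λ i → cong₂ ℤ._*_ (a≗a' i) (b≗b' (n ∸ i))) (upTo (suc n)))

·ₛ-distribˡ--ₛ : ∀ (a b c : Series) n → (a ·ₛ (b -ₛ c)) n ≡ (a ·ₛ b) n ℤ.- (a ·ₛ c) n
·ₛ-distribˡ--ₛ a b c n =
  trans (cong (foldr ℤ._+_ 0ℤ) (map-cong distrib (upTo (suc n))))
        (sumℤ-map-- (λ i → a i ℤ.* b (n ∸ i)) (λ i → a i ℤ.* c (n ∸ i)) (upTo (suc n)))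
  where
  distrib : ∀ i → a i ℤ.* (b (n ∸ i) ℤ.- c (n ∸ i)) ≡ a i ℤ.* b (n ∸ i) ℤ.- a i ℤ.* c (n ∸ i)
  distrib i = trans (ℤP.*-distribˡ-+ (a i) (b (n ∸ i)) _)
                    (cong (λ z → a i ℤ.* b (n ∸ i) ℤ.+ z) (sym (ℤP.neg-distribʳ-* (a i) (c (n ∸ i)))))

·ₛ-pos : ∀ (a b : ℕ → ℕ) n → ((λ i → ℤ.+ a i) ·ₛ (λ i → ℤ.+ b i)) n ≡ ℤ.+ (a ⋆ b) n
·ₛ-pos a b n =
  trans (cong (foldr ℤ._+_ 0ℤ) (map-cong (λ i → sym (ℤP.pos-* (a i) (b (n ∸ i)))) (upTo (suc n))))
        (sumℤ-map-pos (λ i → a i * b (n ∸ i)) (upTo (suc n)))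

[m+n]-n≡m : ∀ m n → ℤ.+ (m + n) ℤ.- ℤ.+ n ≡ ℤ.+ m
[m+n]-n≡m m n = begin
  ℤ.+ (m + n) ℤ.- ℤ.+ n   ≡⟨ ℤP.m-n≡m⊖n (m + n) n ⟩
  (m + n) ℤ.⊖ n           ≡⟨ ℤP.⊖-≥ (m≤n+m n m) ⟩
  ℤ.+ (m + n ∸ n)         ≡⟨ cong ℤ.+_ (m+n∸n≡m m n) ⟩
  ℤ.+ m                   ∎

genFun-solution : ∀ (g x : ℕ → ℕ) → g 0 ≡ 0 → x 0 ≡ 1 →
                  (∀ n → x (suc n) ≡ (g ⋆ x) (suc n)) →
                  ∀ n → (genFun x ·ₛ (oneₛ -ₛ (λ k → ℤ.+ g k))) n ≡ ℤ.+ g n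
genFun-solution g x g0 x0 x-rec n = begin
  (genFun x ·ₛ (oneₛ -ₛ G)) n
    ≡⟨ ·ₛ-distribˡ--ₛ (genFun x) oneₛ G n ⟩
  (genFun x ·ₛ oneₛ) n ℤ.- (genFun x ·ₛ G) n
    ≡⟨ cong₂ ℤ._-_ (·ₛ-cong genFun≗ oneₛ≗ n) (·ₛ-cong {b = G} genFun≗ (λ _ → refl) n) ⟩
  ((λ i → ℤ.+ x₊ i) ·ₛ (λ i → ℤ.+ δ 0 i)) n ℤ.- ((λ i → ℤ.+ x₊ i) ·ₛ G) n
    ≡⟨ cong₂ ℤ._-_ (·ₛ-pos x₊ (δ 0) n) (·ₛ-pos x₊ g n) ⟩
  ℤ.+ (x₊ ⋆ δ 0) n ℤ.- ℤ.+ (x₊ ⋆ g) n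
    ≡⟨ cong (λ c → ℤ.+ c ℤ.- ℤ.+ (x₊ ⋆ g) n) (trans (⋆-identityʳ x₊ n) (x₊-rec n)) ⟩
  ℤ.+ (g n + (x₊ ⋆ g) n) ℤ.- ℤ.+ (x₊ ⋆ g) n
    ≡⟨ [m+n]-n≡m (g n) ((x₊ ⋆ g) n) ⟩
  ℤ.+ g n ∎
  where
  G : Series
  G k = ℤ.+ g k

  x₊ : ℕ → ℕ
  x₊ zero    = 0
  x₊ (suc n) = x (suc n)

  genFun≗ : genFun x ≗ λ i → ℤ.+ x₊ i
  genFun≗ zero    = refl
  genFun≗ (suc _) = refl

  oneₛ≗ : oneₛ ≗ λ i → ℤ.+ δ 0 i
  oneₛ≗ zero    = refl
  oneₛ≗ (suc _) = refl

  x₊-rec : ∀ n → x₊ n ≡ g n + (x₊ ⋆ g) n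
  x₊-rec zero    = sym (trans (+-identityʳ (g 0)) g0)
  x₊-rec (suc n) = begin
    x (suc n)                                 ≡⟨ x-rec n ⟩
    (g ⋆ x) (suc n)                           ≡⟨ ⋆-comm g x (suc n) ⟩
    (x ⋆ g) (suc n)                           ≡⟨ ⋆-suc x g n ⟩
    x 0 * g (suc n) + ((x ∘ suc) ⋆ g) n       ≡⟨ cong (λ c → c * g (suc n) + ((x ∘ suc) ⋆ g) n) x0 ⟩
    1 * g (suc n) + ((x ∘ suc) ⋆ g) n         ≡⟨ cong (_+ ((x ∘ suc) ⋆ g) n) (*-identityˡ (g (suc n))) ⟩
    g (suc n) + ((x ∘ suc) ⋆ g) n             ≡⟨ cong (g (suc n) +_) (⋆-suc x₊ g n) ⟨
    g (suc n) + (x₊ ⋆ g) (suc n)              ∎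

theorem16 : (J : List ℕ) → Unique J → J ≢ [] → All (0 <_) J →
    (x : ℕ → ℕ) → x 0 ≡ 1 → (∀ n → x (suc n) ≡ recSum J x (suc n)) →
    (∀ n → x (suc n) ≡ compCount J (suc n))
    × (∀ n → (genFun x ·ₛ (oneₛ -ₛ Jpoly J)) n ≡ Jpoly J n)
    × (∀ n → x (suc n) ≡ piRowSum (indicator J) n)
theorem16 J J-unique _ J-pos x x0 x-rec =
    Compositions.compCount-solution J J-pos x x0 x-rec
  , genFun-solution g x g0 x0 x-conv
  , PITree.piRowSum-solution g x x0 x-conv⁺
  where
  g : ℕ → ℕ
  g = indicator J

  g0 : g 0 ≡ 0
  g0 = indicator-∉ (All.map <⇒≢ J-pos)

  x-conv : ∀ n → x (suc n) ≡ (g ⋆ x) (suc n)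
  x-conv n = trans (x-rec n) (recSum-⋆ J-unique x (suc n))

  x-conv⁺ : ∀ n → x (suc n) ≡ ((g ∘ suc) ⋆ x) n
  x-conv⁺ n = trans (x-conv n) (trans (⋆-suc g x n) (cong (λ c → c * x (suc n) + ((g ∘ suc) ⋆ x) n) g0))
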